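{- Let $n\ge 1$ and let $\lambda,\mu,\nu\vdash n$ be partitions with $\ell(\lambda)=\ell$, $\ell(\mu)=m$ and $\ell(\nu)=r$. Then $$g(\lambda,\mu,\nu)\;\le\;\left(1+\frac{\ell m r}{n}\right)^{n}\left(1+\frac{n}{\ell m r}\right)^{\ell m r}.$$
   Context: For a partition $\lambda$, $\ell(\lambda)$ denotes its number of (nonzero) parts. For $\lambda\vdash n$, $\chi^\lambda$ denotes the irreducible character of the symmetric group $S_n$ indexed by $\lambda$. The Kronecker coefficient is $g(\lambda,\mu,\nu)=\frac{1}{n!}\sum_{\sigma\in S_n}\chi^\lambda(\sigma)\chi^\mu(\sigma)\chi^\nu(\sigma)$, equivalently the multiplicity of $\chi^\lambda$ in $\chi^\mu\cdot\chi^\nu$. -}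

module Defs where

open import Data.Bool using (Bool; true; false; if_then_else_; _∧_)
open import Data.Nat as ℕ using (ℕ; zero; suc; _≥_; _<_; _≡ᵇ_; _<ᵇ_; _⊓_; _∸_)
open import Data.Nat using (_!)
open import Data.Nat.ListAction using (sum; product)
open import Data.Bool.ListAction using (and)
open import Data.Integer as ℤ using (ℤ; +_; -[1+_])
open import Data.Rational as ℚ using (ℚ; 0ℚ; 1ℚ)
open import Data.List using (List; []; _∷_; map; concatMap; foldr; length; filterᵇ; upTo; zip; zipWith)
open import Data.List.Relation.Unary.All using (All)
open import Data.List.Relation.Unary.Linked using (Linked)
open import Data.Product using (_,_)
open import Relation.Nullary using (does)
open import Relation.Binary.PropositionalEquality using (_≡_)

record Partition (n : ℕ) : Set where
  constructor mkPartition
  field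
    parts      : List ℕ
    decreasing : Linked _≥_ parts
    positive   : All (0 <_) parts
    total      : sum parts ≡ n
open Partition public

len : ∀ {n} → Partition n → ℕ
len p = length (parts p)

-- Enumeration of all partitions of n (as lists), used for the class sum.
-- pg fuel k m : partitions of k with all parts ≤ m, in weakly decreasing order.

pg : ℕ → ℕ → ℕ → List (List ℕ)
pg _        zero    _ = [] ∷ []
pg zero     (suc _) _ = []
pg (suc f)  (suc k) m =
  concatMap (λ i → map (i ∷_) (pg f (suc k ∸ i) i)) (map suc (upTo (suc k ⊓ m)))

partitionsOf : ℕ → List (List ℕ)
partitionsOf n = pg n n n

-- Irreducible characters χ^λ(ρ) of S_n, via the Jacobi–Trudi / Frobenius
-- formula  χ^λ(ρ) = ⟨s_λ , p_ρ⟩ = Σ_{w ∈ S_L} sgn(w) ⟨h_{α(w)} , p_ρ⟩,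
-- α(w)_i = λ_i - i + w(i)  (0-indexed, L = ℓ(λ)), where ⟨h_α , p_ρ⟩ is the
-- number of maps f : {parts of ρ} → {0..L-1} with Σ_{j : f j = i} ρ_j = α_i.

insertAll : ℕ → List ℕ → List (List ℕ)
insertAll x []       = (x ∷ []) ∷ []
insertAll x (y ∷ ys) = (x ∷ y ∷ ys) ∷ map (y ∷_) (insertAll x ys)

perms : List ℕ → List (List ℕ)
perms []       = [] ∷ []
perms (x ∷ xs) = concatMap (insertAll x) (perms xs)

inversions : List ℕ → ℕ
inversions []       = 0
inversions (x ∷ xs) = length (filterᵇ (_<ᵇ x) xs) ℕ.+ inversions xs

sgn : List ℕ → ℤ
sgn w = -[1+ 0 ] ℤ.^ inversions w

assignments : ℕ → ℕ → List (List ℕ)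
assignments L zero    = [] ∷ []
assignments L (suc k) = concatMap (λ b → map (b ∷_) (assignments L k)) (upTo L)

boxSum : List ℕ → List ℕ → ℕ → ℕ
boxSum (p ∷ ps) (b ∷ bs) i = (if b ≡ᵇ i then p else 0) ℕ.+ boxSum ps bs i
boxSum _        _        _ = 0

alpha : List ℕ → List ℕ → List ℤ
alpha lam w = zipWith (λ (li , i) wi → (+ li ℤ.- + i) ℤ.+ + wi) (zip lam (upTo (length lam))) w

matches : List ℕ → List ℤ → List ℕ → Bool
matches rho α f =
  and (zipWith (λ i ai → does (+ boxSum rho f i ℤ.≟ ai)) (upTo (length α)) α)

hCount : List ℕ → List ℤ → ℕ
hCount rho α = length (filterᵇ (matches rho α) (assignments (length α) (length rho)))

sumℤ : List ℤ → ℤ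
sumℤ = foldr ℤ._+_ (+ 0)

χ : List ℕ → List ℕ → ℤ
χ lam rho = sumℤ (map (λ w → sgn w ℤ.* + hCount rho (alpha lam w)) (perms (upTo (length lam))))

-- z_ρ = Π_i i^{m_i} m_i!  (so |class of ρ| = n!/z_ρ)

mult : ℕ → List ℕ → ℕ
mult i rho = length (filterᵇ (_≡ᵇ i) rho)

zρ : List ℕ → ℕ
zρ rho = product rho ℕ.* product (map (λ i → mult (suc i) rho !) (upTo (sum rho)))

-- p / q in ℚ, with the (irrelevant here) convention p / 0 = 0
frac : ℤ → ℕ → ℚ
frac p zero    = 0ℚ
frac p (suc q) = p ℚ./ suc q

powℚ : ℚ → ℕ → ℚ
powℚ x zero    = 1ℚ
powℚ x (suc k) = x ℚ.* powℚ x k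

sumℚ : List ℚ → ℚ
sumℚ = foldr ℚ._+_ 0ℚ

-- Kronecker coefficient
--   g(λ,μ,ν) = (1/n!) Σ_{σ ∈ S_n} χ^λ(σ) χ^μ(σ) χ^ν(σ)
--            = Σ_{ρ ⊢ n} z_ρ⁻¹ χ^λ(ρ) χ^μ(ρ) χ^ν(ρ)
-- (grouping permutations by cycle type ρ; the class of ρ has n!/z_ρ elements)

kron : ∀ {n} → Partition n → Partition n → Partition n → ℚ
kron {n} la mu nu =
  sumℚ (map (λ rho → frac (χ (parts la) rho ℤ.* χ (parts mu) rho ℤ.* χ (parts nu) rho) (zρ rho))
            (partitionsOf n))

-- Expanding χ^λ(ρ) by the Jacobi–Trudi formula, each assignment of the cycles of ρ to the
-- ℓ(λ) rows contributes to at most one permutation, so |χ^λ(ρ)| ≤ ℓ(λ)^ℓ(ρ) and hence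
-- g(λ,μ,ν) ≤ a_n = Σ_{ρ ⊢ n} x^ℓ(ρ) / z_ρ with x = ℓmr.  The generating function of (a_n) is
-- Π_i exp(x tⁱ / i) = (1 - t)^(-x), which gives Newton's identity n a_n = x (a_0 + ⋯ + a_{n-1})
-- and then a_0 + ⋯ + a_n = C(x + n, n).  Finally C(x + n, n) n^n x^x is a single term of the
-- binomial expansion of (n + x)^(n + x).

module Submission where

open import Defs
open import Data.Bool using (Bool; true; false; T)
open import Data.Empty using (⊥-elim)
open import Data.Nat using (ℕ)
open import Data.List using (List; []; _∷_; map; length; filterᵇ; upTo; zip; zipWith; concatMap; replicate; _++_; [_])
import Data.List.Properties as Listₚ
open import Data.List.Membership.Propositional using (_∈_; _∉_; find)
open import Data.List.Membership.Propositional.Properties using (∈-map⁻; ∈-concatMap⁻; ∈-filter⁻; ∈-upTo⁻)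
open import Data.List.Relation.Unary.Any using (here; there)
open import Data.List.Relation.Unary.All as All using (All; []; _∷_)
import Data.List.Relation.Unary.All.Properties as Allₚ
open import Data.List.Relation.Unary.AllPairs using ([]; _∷_)
open import Data.List.Relation.Unary.Unique.Propositional using (Unique)
import Data.List.Relation.Unary.Unique.Propositional.Properties as Uniqueₚ
open import Data.List.Relation.Binary.Disjoint.Propositional using (Disjoint)
open import Data.Product using (_,_)
open import Data.Sum as Sum using (_⊎_; inj₁; inj₂)
open import Function using (_∘_)
open import Relation.Binary.PropositionalEquality hiding ([_])
open import Relation.Nullary using (yes; no; does)

concatMap-unique : ∀ {A B : Set} (f : A → List B) (g : B → A) {xs} → Unique xs →
                   (∀ {x} → x ∈ xs → Unique (f x)) →
                   (∀ {x b} → x ∈ xs → b ∈ f x → g b ≡ x) →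
                   Unique (concatMap f xs)
concatMap-unique f g {[]}     _           _      _      = []
concatMap-unique f g {x ∷ xs} (x∉ ∷ uniq) f-uniq g-inv =
  Uniqueₚ.++⁺ (f-uniq (here refl))
              (concatMap-unique f g uniq (f-uniq ∘ there) (g-inv ∘ there))
              disjoint
  where
  disjoint : Disjoint (f x) (concatMap f xs)
  disjoint (b∈fx , b∈rest) with find (∈-concatMap⁻ f b∈rest)
  ... | y , y∈xs , b∈fy =
    All.lookup x∉ y∈xs (trans (sym (g-inv (here refl) b∈fx)) (g-inv (there y∈xs) b∈fy))

module Permutations where

  open import Data.Nat using (suc; _≟_)

  delete : ℕ → List ℕ → List ℕ
  delete x []       = []
  delete x (y ∷ ys) with x ≟ y
  ... | yes _ = ys
  ... | no  _ = y ∷ delete x ys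

  delete-head : ∀ x ys → delete x (x ∷ ys) ≡ ys
  delete-head x ys with x ≟ x
  ... | yes _  = refl
  ... | no x≢x = ⊥-elim (x≢x refl)

  delete-∷ : ∀ {x y} ys → x ≢ y → delete x (y ∷ ys) ≡ y ∷ delete x ys
  delete-∷ {x} {y} ys x≢y with x ≟ y
  ... | yes x≡y = ⊥-elim (x≢y x≡y)
  ... | no  _   = refl

  ∈-insertAll⇒delete≡ : ∀ {x a} ys → x ∉ ys → a ∈ insertAll x ys → delete x a ≡ ys
  ∈-insertAll⇒delete≡ {x} []       _  (here refl) = delete-head x []
  ∈-insertAll⇒delete≡ {x} (y ∷ ys) _  (here refl) = delete-head x (y ∷ ys)
  ∈-insertAll⇒delete≡ {x} (y ∷ ys) x∉ (there a∈) with ∈-map⁻ (y ∷_) a∈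
  ... | a , a∈′ , refl =
    trans (delete-∷ a (x∉ ∘ here)) (cong (y ∷_) (∈-insertAll⇒delete≡ ys (x∉ ∘ there) a∈′))

  ∈-insertAll⇒length : ∀ {x a} ys → a ∈ insertAll x ys → length a ≡ suc (length ys)
  ∈-insertAll⇒length []       (here refl) = refl
  ∈-insertAll⇒length (y ∷ ys) (here refl) = refl
  ∈-insertAll⇒length (y ∷ ys) (there a∈) with ∈-map⁻ (y ∷_) a∈
  ... | a , a∈′ , refl = cong suc (∈-insertAll⇒length ys a∈′)

  ∈-insertAll⇒∈ : ∀ {x a t} ys → a ∈ insertAll x ys → t ∈ a → t ≡ x ⊎ t ∈ ys
  ∈-insertAll⇒∈ []       (here refl) (here t≡x) = inj₁ t≡x
  ∈-insertAll⇒∈ (y ∷ ys) (here refl) (here t≡x) = inj₁ t≡x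
  ∈-insertAll⇒∈ (y ∷ ys) (here refl) (there t∈) = inj₂ t∈
  ∈-insertAll⇒∈ (y ∷ ys) (there a∈)  t∈a with ∈-map⁻ (y ∷_) a∈
  ... | a , a∈′ , refl with t∈a
  ...   | here t≡y = inj₂ (here t≡y)
  ...   | there t∈ = Sum.map₂ there (∈-insertAll⇒∈ ys a∈′ t∈)

  insertAll-unique : ∀ {x} ys → x ∉ ys → Unique (insertAll x ys)
  insertAll-unique []       _  = [] ∷ []
  insertAll-unique (y ∷ ys) x∉ =
    Allₚ.map⁺ (All.universal (λ _ eq → x∉ (here (Listₚ.∷-injectiveˡ eq))) (insertAll _ ys))
    ∷ Uniqueₚ.map⁺ Listₚ.∷-injectiveʳ (insertAll-unique ys (x∉ ∘ there))

  ∈-perms⇒length : ∀ {a} xs → a ∈ perms xs → length a ≡ length xs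
  ∈-perms⇒length []       (here refl) = refl
  ∈-perms⇒length (x ∷ xs) a∈ with find (∈-concatMap⁻ (insertAll x) {perms xs} a∈)
  ... | ys , ys∈ , a∈′ = trans (∈-insertAll⇒length ys a∈′) (cong suc (∈-perms⇒length xs ys∈))

  ∈-perms⇒⊆ : ∀ {a t} xs → a ∈ perms xs → t ∈ a → t ∈ xs
  ∈-perms⇒⊆ []       (here refl) ()
  ∈-perms⇒⊆ (x ∷ xs) a∈ t∈a with find (∈-concatMap⁻ (insertAll x) {perms xs} a∈)
  ... | ys , ys∈ , a∈′ with ∈-insertAll⇒∈ ys a∈′ t∈a
  ...   | inj₁ t≡x  = here t≡x
  ...   | inj₂ t∈ys = there (∈-perms⇒⊆ xs ys∈ t∈ys)

  perms-unique : ∀ xs → Unique xs → Unique (perms xs)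
  perms-unique []       _           = [] ∷ []
  perms-unique (x ∷ xs) (x∉ ∷ uniq) =
    concatMap-unique (insertAll x) (delete x) (perms-unique xs uniq)
      (λ ys∈ → insertAll-unique _ (fresh ys∈))
      (λ ys∈ a∈ → ∈-insertAll⇒delete≡ _ (fresh ys∈) a∈)
    where
    fresh : ∀ {ys} → ys ∈ perms xs → x ∉ ys
    fresh ys∈ x∈ys = All.lookup x∉ (∈-perms⇒⊆ xs ys∈ x∈ys) refl

module CharacterBound where

  open import Data.Nat as ℕ using (zero; suc; _+_; _*_; _^_; _≤_; z≤n; s≤s)
  import Data.Nat.Properties as ℕₚ
  open import Data.Nat.ListAction using (sum)
  open import Data.Integer as ℤ using (ℤ; +_; -[1+_]; ∣_∣)
  import Data.Integer.Properties as ℤₚ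
  open import Data.Bool.ListAction using (and)
  open import Data.Bool.Properties using (T?)
  open import Algebra.Bundles using (AbelianGroup)
  import Algebra.Properties.Group (AbelianGroup.group ℤₚ.+-0-abelianGroup) as ℤ+
  open import Algebra.Properties.CommutativeSemigroup ℕₚ.+-commutativeSemigroup using (x∙yz≈y∙xz)
  open Permutations using (∈-perms⇒length; perms-unique)

  +-exchange : ∀ l {m} n k → m ≡ n + k → l + m ≡ n + (l + k)
  +-exchange l n k refl = x∙yz≈y∙xz l n k

  unique∧allEqual⇒length≤1 : ∀ {A : Set} {xs : List A} → Unique xs →
                             (∀ {x y} → x ∈ xs → y ∈ xs → x ≡ y) → length xs ≤ 1
  unique∧allEqual⇒length≤1 {xs = []}         _                  _   = z≤n
  unique∧allEqual⇒length≤1 {xs = _ ∷ []}     _                  _   = s≤s z≤n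
  unique∧allEqual⇒length≤1 {xs = _ ∷ _ ∷ _} ((x≢y ∷ _) ∷ _) all≡ =
    ⊥-elim (x≢y (all≡ (here refl) (there (here refl))))

  module _ {A B : Set} (P : A → B → Bool) where

    countHits : List B → List A → ℕ
    countHits bs ws = sum (map (λ w → length (filterᵇ (P w) bs)) ws)

    countHits-[] : ∀ ws → countHits [] ws ≡ 0
    countHits-[] []       = refl
    countHits-[] (w ∷ ws) = countHits-[] ws

    countHits-∷ : ∀ b bs ws → countHits (b ∷ bs) ws ≡ length (filterᵇ (λ w → P w b) ws) + countHits bs ws
    countHits-∷ b bs []       = refl
    countHits-∷ b bs (w ∷ ws) with P w b
    ... | true  = cong suc (+-exchange (length (filterᵇ (P w) bs)) _ (countHits bs ws) (countHits-∷ b bs ws))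
    ... | false = +-exchange (length (filterᵇ (P w) bs)) _ (countHits bs ws) (countHits-∷ b bs ws)

    countHits≤length : ∀ bs {ws} → Unique ws →
                       (∀ {w w′ b} → w ∈ ws → w′ ∈ ws → T (P w b) → T (P w′ b) → w ≡ w′) →
                       countHits bs ws ≤ length bs
    countHits≤length []       {ws} _    _      = ℕₚ.≤-reflexive (countHits-[] ws)
    countHits≤length (b ∷ bs) {ws} uniq single = begin
      countHits (b ∷ bs) ws                                ≡⟨ countHits-∷ b bs ws ⟩
      length (filterᵇ (λ w → P w b) ws) + countHits bs ws  ≤⟨ ℕₚ.+-mono-≤ hits≤1 (countHits≤length bs uniq single) ⟩
      suc (length bs)                                      ∎
      where
      open ℕₚ.≤-Reasoning
      hits≤1 : length (filterᵇ (λ w → P w b) ws) ≤ 1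
      hits≤1 = unique∧allEqual⇒length≤1 (Uniqueₚ.filter⁺ (T? ∘ (λ w → P w b)) uniq) λ w∈ w′∈ →
        let w∈ws , Pw = ∈-filter⁻ (T? ∘ (λ w → P w b)) w∈
            w′∈ws , Pw′ = ∈-filter⁻ (T? ∘ (λ w → P w b)) w′∈
        in single w∈ws w′∈ws Pw Pw′

  and-zipWith-≟⇒≡map : ∀ (g : ℕ → ℤ) is as → length is ≡ length as →
                       T (and (zipWith (λ i a → does (g i ℤ.≟ a)) is as)) → as ≡ map g is
  and-zipWith-≟⇒≡map g []       []       _     _  = refl
  and-zipWith-≟⇒≡map g (i ∷ is) (a ∷ as) |is|≡ hit with g i ℤ.≟ a
  ... | yes gi≡a = cong₂ _∷_ (sym gi≡a) (and-zipWith-≟⇒≡map g is as (ℕₚ.suc-injective |is|≡) hit)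
  ... | no  _    = ⊥-elim hit

  matches⇒≡boxSums : ∀ rho α f → T (matches rho α f) →
                     α ≡ map (λ i → + boxSum rho f i) (upTo (length α))
  matches⇒≡boxSums rho α f =
    and-zipWith-≟⇒≡map (λ i → + boxSum rho f i) (upTo (length α)) α (Listₚ.length-upTo (length α))

  zipWith-injectiveʳ : ∀ {A B C : Set} (h : A → B → C) → (∀ a {b b′} → h a b ≡ h a b′ → b ≡ b′) →
                       ∀ as {bs bs′} → length bs ≡ length as → length bs′ ≡ length as →
                       zipWith h as bs ≡ zipWith h as bs′ → bs ≡ bs′
  zipWith-injectiveʳ h inj []       {[]}    {[]}      _    _     _  = refl
  zipWith-injectiveʳ h inj (a ∷ as) {b ∷ bs} {b′ ∷ bs′} |bs| |bs′| eq =
    cong₂ _∷_ (inj a (Listₚ.∷-injectiveˡ eq))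
              (zipWith-injectiveʳ h inj as (ℕₚ.suc-injective |bs|) (ℕₚ.suc-injective |bs′|) (Listₚ.∷-injectiveʳ eq))

  length-zip-upTo : ∀ (lam : List ℕ) → length (zip lam (upTo (length lam))) ≡ length lam
  length-zip-upTo lam = trans (Listₚ.length-zipWith _,_ lam (upTo (length lam)))
    (trans (cong (length lam ℕ.⊓_) (Listₚ.length-upTo (length lam))) (ℕₚ.⊓-idem (length lam)))

  length-alpha : ∀ lam w → length w ≡ length lam → length (alpha lam w) ≡ length lam
  length-alpha lam w |w| = trans (Listₚ.length-zipWith _ (zip lam (upTo (length lam))) w)
    (trans (cong₂ ℕ._⊓_ (length-zip-upTo lam) |w|) (ℕₚ.⊓-idem (length lam)))

  alpha-injective : ∀ lam {w w′} → length w ≡ length lam → length w′ ≡ length lam →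
                    alpha lam w ≡ alpha lam w′ → w ≡ w′
  alpha-injective lam |w| |w′| =
    zipWith-injectiveʳ _ (λ (li , i) eq → ℤₚ.+-injective (ℤ+.∙-cancelˡ (+ li ℤ.- + i) _ _ eq))
      (zip lam (upTo (length lam)))
      (trans |w| (sym (length-zip-upTo lam))) (trans |w′| (sym (length-zip-upTo lam)))

  ∣-1^k∣≡1 : ∀ k → ∣ -[1+ 0 ] ℤ.^ k ∣ ≡ 1
  ∣-1^k∣≡1 zero    = refl
  ∣-1^k∣≡1 (suc k) = trans (ℤₚ.abs-* -[1+ 0 ] (-[1+ 0 ] ℤ.^ k)) (cong (1 *_) (∣-1^k∣≡1 k))

  ∣sgn*∣≡ : ∀ w h → ∣ sgn w ℤ.* + h ∣ ≡ h
  ∣sgn*∣≡ w h = trans (ℤₚ.abs-* (sgn w) (+ h))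
    (trans (cong (_* h) (∣-1^k∣≡1 (inversions w))) (ℕₚ.*-identityˡ h))

  ∣sumℤ∣≤sum∣∣ : ∀ {A : Set} (f : A → ℤ) xs → ∣ sumℤ (map f xs) ∣ ≤ sum (map (λ x → ∣ f x ∣) xs)
  ∣sumℤ∣≤sum∣∣ f []       = z≤n
  ∣sumℤ∣≤sum∣∣ f (x ∷ xs) =
    ℕₚ.≤-trans (ℤₚ.∣i+j∣≤∣i∣+∣j∣ (f x) (sumℤ (map f xs)))
               (ℕₚ.+-monoʳ-≤ ∣ f x ∣ (∣sumℤ∣≤sum∣∣ f xs))

  length-assignments : ∀ L k → length (assignments L k) ≡ L ^ k
  length-assignments L zero    = refl
  length-assignments L (suc k) = trans (length-prefixed (upTo L)) (cong (_* L ^ k) (Listₚ.length-upTo L))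
    where
    length-prefixed : ∀ bs → length (concatMap (λ b → map (b ∷_) (assignments L k)) bs) ≡ length bs * L ^ k
    length-prefixed []       = refl
    length-prefixed (b ∷ bs) = trans (Listₚ.length-++ (map (b ∷_) (assignments L k)))
      (cong₂ _+_ (trans (Listₚ.length-map (b ∷_) (assignments L k)) (length-assignments L k)) (length-prefixed bs))

  -- An assignment f contributes to ⟨h_α(w), p_ρ⟩ only for the one w with α(w) = (boxSum ρ f i)ᵢ.
  ∣χ∣≤ : ∀ lam rho → ∣ χ lam rho ∣ ≤ length lam ^ length rho
  ∣χ∣≤ lam rho = begin
    ∣ χ lam rho ∣                     ≤⟨ ∣sumℤ∣≤sum∣∣ term W ⟩
    sum (map (λ w → ∣ term w ∣) W)    ≡⟨ cong sum (Listₚ.map-cong-local (All.tabulate hCount≡)) ⟩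
    countHits P (assignments L k) W   ≤⟨ countHits≤length P (assignments L k) (perms-unique (upTo L) (Uniqueₚ.upTo⁺ L)) single ⟩
    length (assignments L k)          ≡⟨ length-assignments L k ⟩
    L ^ k                             ∎
    where
    open ℕₚ.≤-Reasoning
    L = length lam
    k = length rho
    W = perms (upTo L)
    term : List ℕ → ℤ
    term w = sgn w ℤ.* + hCount rho (alpha lam w)
    P : List ℕ → List ℕ → Bool
    P w = matches rho (alpha lam w)
    |w|≡L : ∀ {w} → w ∈ W → length w ≡ L
    |w|≡L w∈ = trans (∈-perms⇒length (upTo L) w∈) (Listₚ.length-upTo L)
    hCount≡ : ∀ {w} → w ∈ W → ∣ term w ∣ ≡ length (filterᵇ (P w) (assignments L k))
    hCount≡ {w} w∈ = trans (∣sgn*∣≡ w _)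
      (cong (λ n → length (filterᵇ (P w) (assignments n k))) (length-alpha lam w (|w|≡L w∈)))
    single : ∀ {w w′ f} → w ∈ W → w′ ∈ W → T (P w f) → T (P w′ f) → w ≡ w′
    single {w} {w′} {f} w∈ w′∈ hit hit′ = alpha-injective lam |w| |w′|
      (trans (matches⇒≡boxSums rho (alpha lam w) f hit)
      (trans (cong (λ n → map (λ i → + boxSum rho f i) (upTo n))
                   (trans (length-alpha lam w |w|) (sym (length-alpha lam w′ |w′|))))
             (sym (matches⇒≡boxSums rho (alpha lam w′) f hit′))))
      where
      |w| = |w|≡L w∈
      |w′| = |w|≡L w′∈

module Rationals where

  open import Data.Nat as ℕ using (zero; suc)
  import Data.Nat.Properties as ℕₚ
  open import Data.Integer as ℤ using (ℤ; +_)
  import Data.Integer.Properties as ℤₚ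
  open import Data.Rational as ℚ using (ℚ; _+_; _*_; _≤_)
  import Data.Rational.Properties as ℚₚ
  open import Data.Rational.Unnormalised as ℚᵘ using (mkℚᵘ; *≡*; *≤*)
  import Data.Rational.Unnormalised.Properties as ℚᵘₚ
  open import Data.Integer.Solver using (module +-*-Solver)
  open +-*-Solver using (solve; _:+_; _:*_; _:=_; con)

  ⟦_⟧ : ℕ → ℚ
  ⟦ k ⟧ = frac (+ k) 1

  toℚᵘ-frac : ∀ p q → ℚ.toℚᵘ (frac p (suc q)) ℚᵘ.≃ mkℚᵘ p q
  toℚᵘ-frac p q = ℚₚ.toℚᵘ-fromℚᵘ (mkℚᵘ p q)

  frac-* : ∀ a b p q → frac (a ℤ.* b) (p ℕ.* q) ≡ frac a p * frac b q
  frac-* a b zero    q       = sym (ℚₚ.*-zeroˡ (frac b q))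
  frac-* a b (suc p) zero    rewrite ℕₚ.*-zeroʳ p = sym (ℚₚ.*-zeroʳ (frac a (suc p)))
  frac-* a b (suc p) (suc q) = ℚₚ.toℚᵘ-injective (ℚᵘₚ.≃-trans (toℚᵘ-frac (a ℤ.* b) (q ℕ.+ p ℕ.* suc q))
    (ℚᵘₚ.≃-sym (ℚᵘₚ.≃-trans (ℚₚ.toℚᵘ-homo-* (frac a (suc p)) (frac b (suc q)))
                            (ℚᵘₚ.*-cong (toℚᵘ-frac a p) (toℚᵘ-frac b q)))))

  frac-mono : ∀ {a b} q → a ℤ.≤ b → frac a q ≤ frac b q
  frac-mono zero    _   = ℚₚ.≤-refl
  frac-mono {a} {b} (suc q) a≤b = ℚₚ.toℚᵘ-cancel-≤
    (ℚᵘₚ.≤-respˡ-≃ (ℚᵘₚ.≃-sym (toℚᵘ-frac a q)) (ℚᵘₚ.≤-respʳ-≃ (ℚᵘₚ.≃-sym (toℚᵘ-frac b q))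
      (*≤* (ℤₚ.*-monoʳ-≤-nonNeg (+ suc q) a≤b))))

  ⟦⟧-* : ∀ a b → ⟦ a ℕ.* b ⟧ ≡ ⟦ a ⟧ * ⟦ b ⟧
  ⟦⟧-* a b = trans (cong (λ i → frac i 1) (ℤₚ.pos-* a b)) (frac-* (+ a) (+ b) 1 1)

  ⟦⟧-+ : ∀ a b → ⟦ a ℕ.+ b ⟧ ≡ ⟦ a ⟧ + ⟦ b ⟧
  ⟦⟧-+ a b = ℚₚ.toℚᵘ-injective (ℚᵘₚ.≃-trans (toℚᵘ-frac (+ (a ℕ.+ b)) 0)
    (ℚᵘₚ.≃-sym (ℚᵘₚ.≃-trans (ℚₚ.toℚᵘ-homo-+ ⟦ a ⟧ ⟦ b ⟧)
      (ℚᵘₚ.≃-trans (ℚᵘₚ.+-cong (toℚᵘ-frac (+ a) 0) (toℚᵘ-frac (+ b) 0)) (*≡* (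
        solve 2 (λ a b → (a :* con (+ 1) :+ b :* con (+ 1)) :* con (+ 1) := (a :+ b) :* con (+ 1)) refl (+ a) (+ b)))))))

  ⟦1+d⟧*a/[1+d]≡⟦a⟧ : ∀ d a → ⟦ suc d ⟧ * frac (+ a) (suc d) ≡ ⟦ a ⟧
  ⟦1+d⟧*a/[1+d]≡⟦a⟧ d a = ℚₚ.toℚᵘ-injective (ℚᵘₚ.≃-trans (ℚₚ.toℚᵘ-homo-* ⟦ suc d ⟧ (frac (+ a) (suc d)))
    (ℚᵘₚ.≃-trans (ℚᵘₚ.*-cong (toℚᵘ-frac (+ suc d) 0) (toℚᵘ-frac (+ a) d))
      (ℚᵘₚ.≃-trans (*≡* (solve 2 (λ n a → (n :* a) :* con (+ 1) := a :* (con (+ 1) :* n)) refl (+ suc d) (+ a)))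
        (ℚᵘₚ.≃-sym (toℚᵘ-frac (+ a) 0)))))

  ⟦⟧-mono : ∀ {a b} → a ℕ.≤ b → ⟦ a ⟧ ≤ ⟦ b ⟧
  ⟦⟧-mono a≤b = frac-mono 1 (ℤ.+≤+ a≤b)

  ⟦⟧*-cancel-≤ : ∀ k .{{_ : ℕ.NonZero k}} {p q} → ⟦ k ⟧ * p ≤ ⟦ k ⟧ * q → p ≤ q
  ⟦⟧*-cancel-≤ k = ℚₚ.*-cancelˡ-≤-pos ⟦ k ⟧ {{ℚₚ.normalize-pos k 1}}

  ⟦⟧*-cancel : ∀ k .{{_ : ℕ.NonZero k}} {p q} → ⟦ k ⟧ * p ≡ ⟦ k ⟧ * q → p ≡ q
  ⟦⟧*-cancel k eq =
    ℚₚ.≤-antisym (⟦⟧*-cancel-≤ k (ℚₚ.≤-reflexive eq)) (⟦⟧*-cancel-≤ k (ℚₚ.≤-reflexive (sym eq)))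

  sumℚ-mono : ∀ {A : Set} {f g : A → ℚ} → (∀ x → f x ≤ g x) → ∀ xs → sumℚ (map f xs) ≤ sumℚ (map g xs)
  sumℚ-mono f≤g []       = ℚₚ.≤-refl
  sumℚ-mono f≤g (x ∷ xs) = ℚₚ.+-mono-≤ (f≤g x) (sumℚ-mono f≤g xs)

  sumℚ-++ : ∀ {A : Set} (f : A → ℚ) xs ys → sumℚ (map f (xs ++ ys)) ≡ sumℚ (map f xs) + sumℚ (map f ys)
  sumℚ-++ f []       ys = sym (ℚₚ.+-identityˡ _)
  sumℚ-++ f (x ∷ xs) ys = trans (cong (λ s → f x + s) (sumℚ-++ f xs ys)) (sym (ℚₚ.+-assoc (f x) _ _))

  sumℚ-*ˡ : ∀ {A : Set} c (f : A → ℚ) xs → sumℚ (map (λ x → c * f x) xs) ≡ c * sumℚ (map f xs)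
  sumℚ-*ˡ c f []       = sym (ℚₚ.*-zeroʳ c)
  sumℚ-*ˡ c f (x ∷ xs) = trans (cong (λ s → c * f x + s) (sumℚ-*ˡ c f xs)) (sym (ℚₚ.*-distribˡ-+ c (f x) _))

module KroneckerBound where

  open import Data.Nat using (zero; suc; _*_; _^_)
  import Data.Nat.Properties as ℕₚ
  open import Data.Integer as ℤ using (ℤ; +_; -[1+_]; ∣_∣)
  import Data.Integer.Properties as ℤₚ
  open import Data.Rational as ℚ using (ℚ)
  open import Data.Nat.Solver using (module +-*-Solver)
  open +-*-Solver using (solve; _:*_; _:=_)
  open CharacterBound using (∣χ∣≤)
  open Rationals using (frac-mono; sumℚ-mono)

  weight : ℕ → List ℕ → ℚ
  weight x ρ = frac (+ (x ^ length ρ)) (zρ ρ)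

  i≤+∣i∣ : ∀ i → i ℤ.≤ + ∣ i ∣
  i≤+∣i∣ (+ n)    = ℤₚ.≤-refl
  i≤+∣i∣ -[1+ n ] = ℤ.-≤+

  ^-distribʳ-* : ∀ a b k → (a * b) ^ k ≡ a ^ k * b ^ k
  ^-distribʳ-* a b zero    = refl
  ^-distribʳ-* a b (suc k) = trans (cong (a * b *_) (^-distribʳ-* a b k))
    (solve 4 (λ a b p q → (a :* b) :* (p :* q) := (a :* p) :* (b :* q)) refl a b (a ^ k) (b ^ k))

  χ³≤ : ∀ l₁ l₂ l₃ rho →
        χ l₁ rho ℤ.* χ l₂ rho ℤ.* χ l₃ rho ℤ.≤ + ((length l₁ * length l₂ * length l₃) ^ length rho)
  χ³≤ l₁ l₂ l₃ rho = ℤₚ.≤-trans (i≤+∣i∣ _) (ℤ.+≤+ (begin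
    ∣ χ l₁ rho ℤ.* χ l₂ rho ℤ.* χ l₃ rho ∣
      ≡⟨ trans (ℤₚ.abs-* (χ l₁ rho ℤ.* χ l₂ rho) (χ l₃ rho))
               (cong (_* ∣ χ l₃ rho ∣) (ℤₚ.abs-* (χ l₁ rho) (χ l₂ rho))) ⟩
    ∣ χ l₁ rho ∣ * ∣ χ l₂ rho ∣ * ∣ χ l₃ rho ∣
      ≤⟨ ℕₚ.*-mono-≤ (ℕₚ.*-mono-≤ (∣χ∣≤ l₁ rho) (∣χ∣≤ l₂ rho)) (∣χ∣≤ l₃ rho) ⟩
    L₁ ^ k * L₂ ^ k * L₃ ^ k
      ≡⟨ trans (^-distribʳ-* (L₁ * L₂) L₃ k) (cong (_* L₃ ^ k) (^-distribʳ-* L₁ L₂ k)) ⟨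
    (L₁ * L₂ * L₃) ^ k
      ∎))
    where
    open ℕₚ.≤-Reasoning
    L₁ = length l₁
    L₂ = length l₂
    L₃ = length l₃
    k = length rho

  kron≤sum-weight : ∀ {n} (la mu nu : Partition n) →
                    kron la mu nu ℚ.≤ sumℚ (map (weight (len la * len mu * len nu)) (partitionsOf n))
  kron≤sum-weight {n} la mu nu =
    sumℚ-mono (λ rho → frac-mono (zρ rho) (χ³≤ (parts la) (parts mu) (parts nu) rho)) (partitionsOf n)

module CentraliserOrder where

  open import Data.Nat as ℕ using (zero; suc; _+_; _*_; _≤_; _<_; _!; _≡ᵇ_; z≤n; s≤s)
  import Data.Nat.Properties as ℕₚ
  open import Data.Nat.ListAction using (sum; product)
  import Data.Nat.ListAction.Properties as ListActionₚ
  open import Data.Bool.Properties using (T?)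
  open import Data.Nat.Solver using (module +-*-Solver)
  open +-*-Solver using (solve; _:*_; _:=_)
  open ≡-Reasoning

  mult-∷-≡ : ∀ a ρ → mult a (a ∷ ρ) ≡ suc (mult a ρ)
  mult-∷-≡ a ρ = cong length (Listₚ.filter-accept (T? ∘ (_≡ᵇ a)) {x = a} {xs = ρ} (ℕₚ.≡⇒≡ᵇ a a refl))

  mult-∷-≢ : ∀ {a v} ρ → a ≢ v → mult v (a ∷ ρ) ≡ mult v ρ
  mult-∷-≢ {a} {v} ρ a≢v =
    cong length (Listₚ.filter-reject (T? ∘ (_≡ᵇ v)) {x = a} {xs = ρ} (a≢v ∘ ℕₚ.≡ᵇ⇒≡ a v))

  mult-absent : ∀ v ρ → sum ρ < v → mult v ρ ≡ 0
  mult-absent v []      _  = refl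
  mult-absent v (a ∷ ρ) lt =
    trans (mult-∷-≢ ρ (λ a≡v → ℕₚ.<-irrefl a≡v (ℕₚ.≤-<-trans (ℕₚ.m≤m+n a (sum ρ)) lt)))
          (mult-absent v ρ (ℕₚ.≤-<-trans (ℕₚ.m≤n+m (sum ρ) a) lt))

  -- zρ ρ = product ρ * multFactorials (sum ρ) ρ
  multFactorials : ℕ → List ℕ → ℕ
  multFactorials N ρ = product (map (λ j → mult (suc j) ρ !) (upTo N))

  multFactorials-suc : ∀ N ρ → multFactorials (suc N) ρ ≡ multFactorials N ρ * mult (suc N) ρ !
  multFactorials-suc N ρ = begin
    product (map f (upTo (suc N)))          ≡⟨ cong (product ∘ map f) (Listₚ.upTo-∷ʳ N) ⟨
    product (map f (upTo N ++ [ N ]))       ≡⟨ cong product (Listₚ.map-++ f (upTo N) [ N ]) ⟩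
    product (map f (upTo N) ++ [ f N ])     ≡⟨ ListActionₚ.product-++ (map f (upTo N)) [ f N ] ⟩
    multFactorials N ρ * (f N * 1)          ≡⟨ cong (multFactorials N ρ *_) (ℕₚ.*-identityʳ (f N)) ⟩
    multFactorials N ρ * f N                ∎
    where
    f = λ j → mult (suc j) ρ !

  multFactorials-+ : ∀ ρ d → multFactorials (sum ρ + d) ρ ≡ multFactorials (sum ρ) ρ
  multFactorials-+ ρ zero    = cong (λ N → multFactorials N ρ) (ℕₚ.+-identityʳ (sum ρ))
  multFactorials-+ ρ (suc d) = begin
    multFactorials (sum ρ + suc d) ρ                              ≡⟨ cong (λ N → multFactorials N ρ) (ℕₚ.+-suc (sum ρ) d) ⟩
    multFactorials (suc (sum ρ + d)) ρ                            ≡⟨ multFactorials-suc (sum ρ + d) ρ ⟩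
    multFactorials (sum ρ + d) ρ * mult (suc (sum ρ + d)) ρ !     ≡⟨ cong (λ m → multFactorials (sum ρ + d) ρ * m !)
                                                                          (mult-absent _ ρ (s≤s (ℕₚ.m≤m+n (sum ρ) d))) ⟩
    multFactorials (sum ρ + d) ρ * 1                              ≡⟨ ℕₚ.*-identityʳ _ ⟩
    multFactorials (sum ρ + d) ρ                                  ≡⟨ multFactorials-+ ρ d ⟩
    multFactorials (sum ρ) ρ                                      ∎

  multFactorials-∷-> : ∀ N i ρ → N < i → multFactorials N (i ∷ ρ) ≡ multFactorials N ρ
  multFactorials-∷-> zero    i ρ _  = refl
  multFactorials-∷-> (suc N) i ρ lt = begin
    multFactorials (suc N) (i ∷ ρ)                      ≡⟨ multFactorials-suc N (i ∷ ρ) ⟩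
    multFactorials N (i ∷ ρ) * mult (suc N) (i ∷ ρ) !   ≡⟨ cong₂ (λ a b → a * b !)
                                                             (multFactorials-∷-> N i ρ (ℕₚ.<-trans (ℕₚ.n<1+n N) lt))
                                                             (mult-∷-≢ ρ (λ i≡1+N → ℕₚ.<-irrefl (sym i≡1+N) lt)) ⟩
    multFactorials N ρ * mult (suc N) ρ !               ≡⟨ multFactorials-suc N ρ ⟨
    multFactorials (suc N) ρ                            ∎

  multFactorials-∷-≤ : ∀ N i ρ → 1 ≤ i → i ≤ N → multFactorials N (i ∷ ρ) ≡ suc (mult i ρ) * multFactorials N ρ
  multFactorials-∷-≤ zero    i ρ 1≤i i≤0 = ⊥-elim (ℕₚ.<-irrefl refl (ℕₚ.≤-trans 1≤i i≤0))
  multFactorials-∷-≤ (suc N) i ρ 1≤i i≤N with i ℕ.≟ suc N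
  ... | yes refl = begin
    multFactorials (suc N) (i ∷ ρ)                ≡⟨ multFactorials-suc N (i ∷ ρ) ⟩
    multFactorials N (i ∷ ρ) * mult i (i ∷ ρ) !   ≡⟨ cong₂ (λ a b → a * b !)
                                                       (multFactorials-∷-> N i ρ (ℕₚ.n<1+n N)) (mult-∷-≡ i ρ) ⟩
    multFactorials N ρ * (suc d * d !)            ≡⟨ ℕₚ.*-assoc (multFactorials N ρ) (suc d) (d !) ⟨
    multFactorials N ρ * suc d * d !              ≡⟨ cong (_* d !) (ℕₚ.*-comm (multFactorials N ρ) (suc d)) ⟩
    suc d * multFactorials N ρ * d !              ≡⟨ ℕₚ.*-assoc (suc d) (multFactorials N ρ) (d !) ⟩
    suc d * (multFactorials N ρ * d !)            ≡⟨ cong (suc d *_) (multFactorials-suc N ρ) ⟨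
    suc d * multFactorials (suc N) ρ              ∎
    where d = mult i ρ
  ... | no i≢1+N = begin
    multFactorials (suc N) (i ∷ ρ)                        ≡⟨ multFactorials-suc N (i ∷ ρ) ⟩
    multFactorials N (i ∷ ρ) * mult (suc N) (i ∷ ρ) !     ≡⟨ cong₂ (λ a b → a * b !)
                                                               (multFactorials-∷-≤ N i ρ 1≤i (ℕₚ.≤-pred (ℕₚ.≤∧≢⇒< i≤N i≢1+N)))
                                                               (mult-∷-≢ ρ i≢1+N) ⟩
    suc d * multFactorials N ρ * mult (suc N) ρ !         ≡⟨ ℕₚ.*-assoc (suc d) (multFactorials N ρ) (mult (suc N) ρ !) ⟩
    suc d * (multFactorials N ρ * mult (suc N) ρ !)       ≡⟨ cong (suc d *_) (multFactorials-suc N ρ) ⟨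
    suc d * multFactorials (suc N) ρ                      ∎
    where d = mult i ρ

  zρ-∷ : ∀ i ρ → zρ (i ∷ ρ) ≡ i * suc (mult i ρ) * zρ ρ
  zρ-∷ zero    ρ = refl
  zρ-∷ (suc i) ρ = begin
    suc i * product ρ * multFactorials (suc i + sum ρ) (suc i ∷ ρ)
      ≡⟨ cong (suc i * product ρ *_)
              (multFactorials-∷-≤ (suc i + sum ρ) (suc i) ρ (s≤s z≤n) (ℕₚ.m≤m+n (suc i) (sum ρ))) ⟩
    suc i * product ρ * (suc d * multFactorials (suc i + sum ρ) ρ)
      ≡⟨ cong (λ m → suc i * product ρ * (suc d * m))
              (trans (cong (λ N → multFactorials N ρ) (ℕₚ.+-comm (suc i) (sum ρ))) (multFactorials-+ ρ (suc i))) ⟩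
    suc i * product ρ * (suc d * multFactorials (sum ρ) ρ)
      ≡⟨ solve 4 (λ a b c e → (a :* b) :* (c :* e) := a :* c :* (b :* e))
               refl (suc i) (product ρ) (suc d) (multFactorials (sum ρ) ρ) ⟩
    suc i * suc d * zρ ρ
      ∎
    where d = mult (suc i) ρ

module Sequences where

  open import Data.Nat as ℕ using (zero; suc; _<_; s≤s)
  import Data.Nat.Properties as ℕₚ
  open import Data.Rational using (ℚ; 0ℚ; _+_; _*_)
  import Data.Rational.Properties as ℚₚ
  open import Data.Rational.Solver using (module +-*-Solver)
  open +-*-Solver using (solve; _:+_; _:*_; _:=_)

  -- Sequences ℕ → ℚ are coefficient sequences of power series in t; shift i multiplies by tⁱ.
  shift : ℕ → (ℕ → ℚ) → ℕ → ℚ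
  shift zero    F k       = F k
  shift (suc i) F zero    = 0ℚ
  shift (suc i) F (suc k) = shift i F k

  -- multiplication by t + t² + ⋯ + tʲ
  shiftSum : (ℕ → ℚ) → ℕ → ℕ → ℚ
  shiftSum F zero    k = 0ℚ
  shiftSum F (suc j) k = shiftSum F j k + shift (suc j) F k

  shift-i+j : ∀ i F j → shift i F (i ℕ.+ j) ≡ F j
  shift-i+j zero    F j = refl
  shift-i+j (suc i) F j = shift-i+j i F j

  shift-< : ∀ i F {k} → k < i → shift i F k ≡ 0ℚ
  shift-< (suc i) F {zero}  _         = refl
  shift-< (suc i) F {suc k} (s≤s k<i) = shift-< i F k<i

  shift-cong : ∀ i {F G} k → (∀ j → i ℕ.+ j ≡ k → F j ≡ G j) → shift i F k ≡ shift i G k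
  shift-cong zero    k       F≡G = F≡G k refl
  shift-cong (suc i) zero    F≡G = refl
  shift-cong (suc i) (suc k) F≡G = shift-cong i k (λ j eq → F≡G j (cong suc eq))

  shift-linear : ∀ i a F G k → shift i (λ j → a * F j + G j) k ≡ a * shift i F k + shift i G k
  shift-linear zero    a F G k       = refl
  shift-linear (suc i) a F G zero    = sym (trans (cong (_+ 0ℚ) (ℚₚ.*-zeroʳ a)) (ℚₚ.+-identityʳ 0ℚ))
  shift-linear (suc i) a F G (suc k) = shift-linear i a F G k

  shift-distrib-+ : ∀ i F G k → shift i (λ j → F j + G j) k ≡ shift i F k + shift i G k
  shift-distrib-+ zero    F G k       = refl
  shift-distrib-+ (suc i) F G zero    = sym (ℚₚ.+-identityʳ 0ℚ)
  shift-distrib-+ (suc i) F G (suc k) = shift-distrib-+ i F G k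

  shift-shift : ∀ i i′ F k → shift i (shift i′ F) k ≡ shift (i ℕ.+ i′) F k
  shift-shift zero    i′ F k       = refl
  shift-shift (suc i) i′ F zero    = refl
  shift-shift (suc i) i′ F (suc k) = shift-shift i i′ F k

  shift-comm : ∀ i i′ F k → shift i (shift i′ F) k ≡ shift i′ (shift i F) k
  shift-comm i i′ F k = trans (shift-shift i i′ F k)
    (trans (cong (λ n → shift n F k) (ℕₚ.+-comm i i′)) (sym (shift-shift i′ i F k)))

  shift-scale : ∀ i (f : ℕ → ℚ) F k → f k * shift i F k ≡ shift i (λ j → f (i ℕ.+ j) * F j) k
  shift-scale zero    f F k       = refl
  shift-scale (suc i) f F zero    = ℚₚ.*-zeroʳ (f zero)
  shift-scale (suc i) f F (suc k) = shift-scale i (f ∘ suc) F k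

  shift-*ˡ : ∀ i a F k → shift i (λ j → a * F j) k ≡ a * shift i F k
  shift-*ˡ i a F k = sym (shift-scale i (λ _ → a) F k)

  shiftSum-cong : ∀ j {F G} k → (∀ u → u < k → F u ≡ G u) → shiftSum F j k ≡ shiftSum G j k
  shiftSum-cong zero    k F≡G = refl
  shiftSum-cong (suc j) k F≡G = cong₂ _+_ (shiftSum-cong j k F≡G)
    (shift-cong (suc j) k (λ u eq → F≡G u (subst (u <_) eq (s≤s (ℕₚ.m≤n+m u j)))))

  shiftSum-linear : ∀ j a F G k → shiftSum (λ u → a * F u + G u) j k ≡ a * shiftSum F j k + shiftSum G j k
  shiftSum-linear zero    a F G k = sym (trans (cong (_+ 0ℚ) (ℚₚ.*-zeroʳ a)) (ℚₚ.+-identityʳ 0ℚ))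
  shiftSum-linear (suc j) a F G k = begin
    shiftSum (λ u → a * F u + G u) j k + shift (suc j) (λ u → a * F u + G u) k
      ≡⟨ cong₂ _+_ (shiftSum-linear j a F G k) (shift-linear (suc j) a F G k) ⟩
    (a * shiftSum F j k + shiftSum G j k) + (a * shift (suc j) F k + shift (suc j) G k)
      ≡⟨ solve 5 (λ a p q r s → (a :* p :+ q) :+ (a :* r :+ s) := a :* (p :+ r) :+ (q :+ s))
               refl a (shiftSum F j k) (shiftSum G j k) (shift (suc j) F k) (shift (suc j) G k) ⟩
    a * (shiftSum F j k + shift (suc j) F k) + (shiftSum G j k + shift (suc j) G k)
      ∎
    where open ≡-Reasoning

  shiftSum-shift : ∀ j i F k → shiftSum (shift i F) j k ≡ shift i (shiftSum F j) k
  shiftSum-shift zero    i F k = sym (shift-zero i k)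
    where
    shift-zero : ∀ i k → shift i (λ _ → 0ℚ) k ≡ 0ℚ
    shift-zero zero    k       = refl
    shift-zero (suc i) zero    = refl
    shift-zero (suc i) (suc k) = shift-zero i k
  shiftSum-shift (suc j) i F k = begin
    shiftSum (shift i F) j k + shift (suc j) (shift i F) k   ≡⟨ cong₂ _+_ (shiftSum-shift j i F k) (shift-comm (suc j) i F k) ⟩
    shift i (shiftSum F j) k + shift i (shift (suc j) F) k   ≡⟨ shift-distrib-+ i (shiftSum F j) (shift (suc j) F) k ⟨
    shift i (shiftSum F (suc j)) k                           ∎
    where open ≡-Reasoning

  shiftSum-suc-suc : ∀ F j k → shiftSum F (suc j) (suc k) ≡ F k + shiftSum F j k
  shiftSum-suc-suc F zero    k = trans (ℚₚ.+-identityˡ (F k)) (sym (ℚₚ.+-identityʳ (F k)))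
  shiftSum-suc-suc F (suc j) k = trans (cong (_+ shift (suc j) F k) (shiftSum-suc-suc F j k)) (ℚₚ.+-assoc (F k) _ _)

module BoundedPartitions where

  open import Data.Nat using (zero; suc; _+_; _∸_; _⊓_; _≤_; s≤s)
  import Data.Nat.Properties as ℕₚ
  open CentraliserOrder using (mult-∷-≢)

  partitions≤ : ℕ → ℕ → List (List ℕ)
  partitions≤ k m = pg k k m

  pg-fuel : ∀ f g k m → k ≤ f → k ≤ g → pg f k m ≡ pg g k m
  pg-fuel f       g       zero    m _         _         = refl
  pg-fuel (suc f) (suc g) (suc k) m (s≤s k≤f) (s≤s k≤g) = begin
    concatMap (λ i → map (i ∷_) (pg f (suc k ∸ i) i)) (map suc (upTo (suc k ⊓ m)))
      ≡⟨ Listₚ.concatMap-map _ suc (upTo (suc k ⊓ m)) ⟩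
    concatMap (λ j → map (suc j ∷_) (pg f (k ∸ j) (suc j))) (upTo (suc k ⊓ m))
      ≡⟨ Listₚ.concatMap-cong (λ j → cong (map (suc j ∷_))
           (pg-fuel f g (k ∸ j) (suc j) (ℕₚ.≤-trans (ℕₚ.m∸n≤m k j) k≤f) (ℕₚ.≤-trans (ℕₚ.m∸n≤m k j) k≤g)))
           (upTo (suc k ⊓ m)) ⟩
    concatMap (λ j → map (suc j ∷_) (pg g (k ∸ j) (suc j))) (upTo (suc k ⊓ m))
      ≡⟨ Listₚ.concatMap-map _ suc (upTo (suc k ⊓ m)) ⟨
    concatMap (λ i → map (i ∷_) (pg g (suc k ∸ i) i)) (map suc (upTo (suc k ⊓ m)))
      ∎
    where open ≡-Reasoning

  partitions≤-split : ∀ m j → partitions≤ (suc m + j) (suc m) ≡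
                      partitions≤ (suc m + j) m ++ map (suc m ∷_) (partitions≤ j (suc m))
  partitions≤-split m j = begin
    parts≤ (suc K ⊓ suc m)                                ≡⟨ cong parts≤ (ℕₚ.m≥n⇒m⊓n≡n (s≤s m≤K)) ⟩
    parts≤ (suc m)                                        ≡⟨ cong (concatMap F ∘ map suc) (Listₚ.upTo-∷ʳ m) ⟨
    concatMap F (map suc (upTo m ++ [ m ]))               ≡⟨ cong (concatMap F) (Listₚ.map-++ suc (upTo m) [ m ]) ⟩
    concatMap F (map suc (upTo m) ++ [ suc m ])           ≡⟨ Listₚ.concatMap-++ F (map suc (upTo m)) [ suc m ] ⟩
    parts≤ m ++ (F (suc m) ++ [])                         ≡⟨ cong₂ _++_ (cong parts≤ (sym (ℕₚ.m≥n⇒m⊓n≡n m≤1+K)))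
                                                                      (trans (Listₚ.++-identityʳ (F (suc m)))
                                                                             (cong (map (suc m ∷_)) largest)) ⟩
    partitions≤ (suc K) m ++ map (suc m ∷_) (partitions≤ j (suc m)) ∎
    where
    open ≡-Reasoning
    K = m + j
    F : ℕ → List (List ℕ)
    F i = map (i ∷_) (pg K (suc K ∸ i) i)
    parts≤ : ℕ → List (List ℕ)
    parts≤ t = concatMap F (map suc (upTo t))
    m≤K : m ≤ K
    m≤K = ℕₚ.m≤m+n m j
    m≤1+K : m ≤ suc K
    m≤1+K = ℕₚ.m≤n⇒m≤1+n m≤K
    largest : pg K (K ∸ m) (suc m) ≡ pg j j (suc m)
    largest = trans (cong (λ t → pg K t (suc m)) (ℕₚ.m+n∸m≡n m j)) (pg-fuel K j j (suc m) (ℕₚ.m≤n+m j m) ℕₚ.≤-refl)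

  partitions≤-large : ∀ k m → k ≤ m → partitions≤ k (suc m) ≡ partitions≤ k m
  partitions≤-large zero    m _   = refl
  partitions≤-large (suc k) m k<m =
    cong (λ t → concatMap (λ i → map (i ∷_) (pg k (suc k ∸ i) i)) (map suc (upTo t)))
         (trans (ℕₚ.m≤n⇒m⊓n≡m (ℕₚ.m≤n⇒m≤1+n k<m)) (sym (ℕₚ.m≤n⇒m⊓n≡m k<m)))

  partitions≤-saturated : ∀ k m → k ≤ m → partitions≤ k m ≡ partitionsOf k
  partitions≤-saturated k m k≤m with ℕₚ.m≤n⇒∃[o]m+o≡n k≤m
  ... | d , refl = bound-k+ d
    where
    bound-k+ : ∀ d → partitions≤ k (k + d) ≡ partitionsOf k
    bound-k+ zero    = cong (partitions≤ k) (ℕₚ.+-identityʳ k)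
    bound-k+ (suc d) = trans (cong (partitions≤ k) (ℕₚ.+-suc k d))
                             (trans (partitions≤-large k (k + d) (ℕₚ.m≤m+n k d)) (bound-k+ d))

  ∈pg⇒parts≤ : ∀ f k m {ρ} → ρ ∈ pg f k m → All (_≤ m) ρ
  ∈pg⇒parts≤ f       zero    m (here refl) = []
  ∈pg⇒parts≤ (suc f) (suc k) m ρ∈ with find (∈-concatMap⁻ _ {map suc (upTo (suc k ⊓ m))} ρ∈)
  ... | i , i∈ , ρ∈′ with ∈-map⁻ suc i∈ | ∈-map⁻ (i ∷_) ρ∈′
  ...   | j , j∈ , refl | ρ′ , ρ′∈ , refl =
    i≤m ∷ All.map (λ p≤i → ℕₚ.≤-trans p≤i i≤m) (∈pg⇒parts≤ f (suc k ∸ suc j) (suc j) ρ′∈)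
    where
    i≤m : suc j ≤ m
    i≤m = ℕₚ.≤-trans (∈-upTo⁻ j∈) (ℕₚ.m⊓n≤n (suc k) m)

  mult-partitions≤ : ∀ k m {ρ} → ρ ∈ partitions≤ k m → mult (suc m) ρ ≡ 0
  mult-partitions≤ k m ρ∈ = no-large-part (∈pg⇒parts≤ k k m ρ∈)
    where
    no-large-part : ∀ {ρ} → All (_≤ m) ρ → mult (suc m) ρ ≡ 0
    no-large-part []           = refl
    no-large-part (a≤m ∷ ρ≤m) =
      trans (mult-∷-≢ {v = suc m} _ (λ a≡1+m → ℕₚ.<-irrefl a≡1+m (s≤s a≤m))) (no-large-part ρ≤m)

module PartitionSums where

  open import Data.Nat as ℕ using (suc; s≤s)
  import Data.Nat.Properties as ℕₚ
  open import Data.Rational using (ℚ; _+_)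
  import Data.Rational.Properties as ℚₚ
  open BoundedPartitions using (partitions≤; partitions≤-large; partitions≤-split)
  open Sequences using (shift; shift-<; shift-i+j)
  open Rationals using (sumℚ-++)

  sum-partitions≤-suc : ∀ (g : List ℕ → ℚ) m k →
    sumℚ (map g (partitions≤ k (suc m))) ≡
    sumℚ (map g (partitions≤ k m)) + shift (suc m) (λ j → sumℚ (map (g ∘ (suc m ∷_)) (partitions≤ j (suc m)))) k
  sum-partitions≤-suc g m k with k ℕ.≤? m
  ... | yes k≤m = trans (cong (sumℚ ∘ map g) (partitions≤-large k m k≤m))
                        (sym (trans (cong (sumℚ (map g (partitions≤ k m)) +_) (shift-< (suc m) _ (s≤s k≤m)))
                                    (ℚₚ.+-identityʳ _)))
  ... | no k≰m with ℕₚ.m≤n⇒∃[o]m+o≡n (ℕₚ.≰⇒> k≰m)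
  ...   | j , refl = begin
    sumℚ (map g (partitions≤ (suc m ℕ.+ j) (suc m)))      ≡⟨ cong (sumℚ ∘ map g) (partitions≤-split m j) ⟩
    sumℚ (map g (P ++ map (suc m ∷_) Q))                  ≡⟨ sumℚ-++ g P (map (suc m ∷_) Q) ⟩
    sumℚ (map g P) + sumℚ (map g (map (suc m ∷_) Q))      ≡⟨ cong (sumℚ (map g P) +_) (cong sumℚ (Listₚ.map-∘ Q)) ⟨
    sumℚ (map g P) + sumℚ (map (g ∘ (suc m ∷_)) Q)        ≡⟨ cong (sumℚ (map g P) +_) (shift-i+j (suc m) _ j) ⟨
    sumℚ (map g P) + shift (suc m) (λ j → sumℚ (map (g ∘ (suc m ∷_)) (partitions≤ j (suc m)))) (suc m ℕ.+ j) ∎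
    where
    open ≡-Reasoning
    P = partitions≤ (suc m ℕ.+ j) m
    Q = partitions≤ j (suc m)

module Newton (x : ℕ) where

  open import Data.Nat as ℕ using (zero; suc; _^_)
  import Data.Nat.Properties as ℕₚ
  open import Data.Nat.Induction using (<-rec)
  open import Data.Integer as ℤ using (+_)
  import Data.Integer.Properties as ℤₚ
  open import Data.Rational using (ℚ; 0ℚ; _+_; _*_)
  import Data.Rational.Properties as ℚₚ
  open import Data.Rational.Solver using (module +-*-Solver)
  open +-*-Solver using (solve; _:+_; _:*_; _:=_)
  open KroneckerBound using (weight)
  open CentraliserOrder using (mult-∷-≡; zρ-∷)
  open BoundedPartitions using (partitions≤; mult-partitions≤)
  open PartitionSums using (sum-partitions≤-suc)
  open Rationals
  open Sequences
  open ≡-Reasoning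

  X : ℚ
  X = ⟦ x ⟧

  w : List ℕ → ℚ
  w = weight x

  w-∷ : ∀ i ρ → w (i ∷ ρ) ≡ frac (+ x) (i ℕ.* suc (mult i ρ)) * w ρ
  w-∷ i ρ = begin
    frac (+ (x ℕ.* x ^ length ρ)) (zρ (i ∷ ρ))
      ≡⟨ cong₂ frac (ℤₚ.pos-* x (x ^ length ρ)) (zρ-∷ i ρ) ⟩
    frac (+ x ℤ.* + (x ^ length ρ)) (i ℕ.* suc (mult i ρ) ℕ.* zρ ρ)
      ≡⟨ frac-* (+ x) (+ (x ^ length ρ)) (i ℕ.* suc (mult i ρ)) (zρ ρ) ⟩
    frac (+ x) (i ℕ.* suc (mult i ρ)) * w ρ
      ∎

  A : ℕ → ℕ → ℚ
  A m k = sumℚ (map w (partitions≤ k m))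

  -- Grouping by the multiplicity c of the largest allowed part m = 1 + m′ gives A m = Σ_c e c · t^{cm} · A m′.
  module Step (m′ : ℕ) (newton-m′ : ∀ k → ⟦ k ⟧ * A m′ k ≡ X * shiftSum (A m′) m′ k) where

    m : ℕ
    m = suc m′

    G : ℕ → ℚ
    G = A m′

    e : ℕ → ℚ
    e c = w (replicate c m)

    e-prev : ℕ → ℚ
    e-prev zero    = 0ℚ
    e-prev (suc c) = e c

    V : ℕ → ℕ → ℚ
    V c k = sumℚ (map (λ ρ → w (replicate c m ++ ρ)) (partitions≤ k m))

    -- V (c - 1), read off V-split with e (-1) = 0
    V-prev : ℕ → ℕ → ℚ
    V-prev c k = e-prev c * G k + shift m (V c) k

    mult-replicate-++ : ∀ c ρ → mult m (replicate c m ++ ρ) ≡ c ℕ.+ mult m ρ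
    mult-replicate-++ zero    ρ = refl
    mult-replicate-++ (suc c) ρ = trans (mult-∷-≡ m (replicate c m ++ ρ)) (cong suc (mult-replicate-++ c ρ))

    e-suc : ∀ c → e (suc c) ≡ frac (+ x) (m ℕ.* suc c) * e c
    e-suc c = trans (w-∷ m (replicate c m))
      (cong (λ d → frac (+ x) (m ℕ.* suc d) * e c)
            (trans (cong (mult m) (sym (Listₚ.++-identityʳ (replicate c m))))
                   (trans (mult-replicate-++ c []) (ℕₚ.+-identityʳ c))))

    e-rec : ∀ c → ⟦ c ℕ.* m ⟧ * e c ≡ X * e-prev c
    e-rec zero    = trans (ℚₚ.*-zeroˡ (e 0)) (sym (ℚₚ.*-zeroʳ X))
    e-rec (suc c) = begin
      ⟦ suc c ℕ.* m ⟧ * e (suc c)                          ≡⟨ cong₂ (λ n q → ⟦ n ⟧ * q) (ℕₚ.*-comm (suc c) m) (e-suc c) ⟩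
      ⟦ m ℕ.* suc c ⟧ * (frac (+ x) (m ℕ.* suc c) * e c)    ≡⟨ ℚₚ.*-assoc ⟦ m ℕ.* suc c ⟧ _ (e c) ⟨
      (⟦ m ℕ.* suc c ⟧ * frac (+ x) (m ℕ.* suc c)) * e c    ≡⟨ cong (_* e c) (⟦1+d⟧*a/[1+d]≡⟦a⟧ (c ℕ.+ m′ ℕ.* suc c) x) ⟩
      X * e c                                              ∎

    w-replicate-++ : ∀ c ρ → mult m ρ ≡ 0 → w (replicate c m ++ ρ) ≡ e c * w ρ
    w-replicate-++ zero    ρ _    = sym (ℚₚ.*-identityˡ (w ρ))
    w-replicate-++ (suc c) ρ no-m = begin
      w (m ∷ replicate c m ++ ρ)
        ≡⟨ w-∷ m (replicate c m ++ ρ) ⟩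
      frac (+ x) (m ℕ.* suc (mult m (replicate c m ++ ρ))) * w (replicate c m ++ ρ)
        ≡⟨ cong₂ (λ d q → frac (+ x) (m ℕ.* suc d) * q)
                 (trans (mult-replicate-++ c ρ) (trans (cong (c ℕ.+_) no-m) (ℕₚ.+-identityʳ c)))
                 (w-replicate-++ c ρ no-m) ⟩
      frac (+ x) (m ℕ.* suc c) * (e c * w ρ)
        ≡⟨ ℚₚ.*-assoc (frac (+ x) (m ℕ.* suc c)) (e c) (w ρ) ⟨
      (frac (+ x) (m ℕ.* suc c) * e c) * w ρ
        ≡⟨ cong (_* w ρ) (e-suc c) ⟨
      e (suc c) * w ρ
        ∎

    replicate-++-∷ : ∀ c (ρ : List ℕ) → replicate c m ++ m ∷ ρ ≡ replicate (suc c) m ++ ρ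
    replicate-++-∷ zero    ρ = refl
    replicate-++-∷ (suc c) ρ = cong (m ∷_) (replicate-++-∷ c ρ)

    V-split : ∀ c k → V c k ≡ e c * G k + shift m (V (suc c)) k
    V-split c k = begin
      V c k
        ≡⟨ sum-partitions≤-suc (λ ρ → w (replicate c m ++ ρ)) m′ k ⟩
      sumℚ (map (λ ρ → w (replicate c m ++ ρ)) (partitions≤ k m′))
        + shift m (λ j → sumℚ (map (λ ρ → w (replicate c m ++ m ∷ ρ)) (partitions≤ j m))) k
        ≡⟨ cong₂ _+_ no-part-m (shift-cong m k (λ j _ →
             cong sumℚ (Listₚ.map-cong (λ ρ → cong w (replicate-++-∷ c ρ)) (partitions≤ j m)))) ⟩
      e c * G k + shift m (V (suc c)) k
        ∎
      where
      no-part-m : sumℚ (map (λ ρ → w (replicate c m ++ ρ)) (partitions≤ k m′)) ≡ e c * G k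
      no-part-m = trans
        (cong sumℚ (Listₚ.map-cong-local (All.tabulate λ ρ∈ → w-replicate-++ c _ (mult-partitions≤ k m′ ρ∈))))
        (sumℚ-*ˡ (e c) w (partitions≤ k m′))

    NewtonV : ℕ → Set
    NewtonV k = ∀ c → ⟦ k ℕ.+ c ℕ.* m ⟧ * V c k ≡ X * (shiftSum (V c) m′ k + V-prev c k)

    -- t^{cm} · V c = Σ_{c′ ≥ c} e c′ · t^{c′m} · G; apply t·d/dt by the product rule, using e-rec and newton-m′
    newton-V-step : ∀ k → (∀ {j} → j ℕ.< k → NewtonV j) → NewtonV k
    newton-V-step k rec c = begin
      ⟦ k ℕ.+ c ℕ.* m ⟧ * V c k
        ≡⟨ cong (⟦ k ℕ.+ c ℕ.* m ⟧ *_) (V-split c k) ⟩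
      ⟦ k ℕ.+ c ℕ.* m ⟧ * (e c * G k + shift m (V (suc c)) k)
        ≡⟨ ℚₚ.*-distribˡ-+ ⟦ k ℕ.+ c ℕ.* m ⟧ (e c * G k) _ ⟩
      ⟦ k ℕ.+ c ℕ.* m ⟧ * (e c * G k) + ⟦ k ℕ.+ c ℕ.* m ⟧ * shift m (V (suc c)) k
        ≡⟨ cong₂ _+_ base-term shifted-term ⟩
      X * (e c * SG + e-prev c * G k) + X * shift m (λ j → shiftSum (V (suc c)) m′ j + V c j) k
        ≡⟨ cong (λ q → X * (e c * SG + e-prev c * G k) + X * q)
                (trans (shift-distrib-+ m (shiftSum (V (suc c)) m′) (V c) k)
                       (cong (_+ shift m (V c) k) (sym (shiftSum-shift m′ m (V (suc c)) k)))) ⟩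
      X * (e c * SG + e-prev c * G k) + X * (SV + shift m (V c) k)
        ≡⟨ solve 7 (λ X E S E′ G S′ H → X :* (E :* S :+ E′ :* G) :+ X :* (S′ :+ H)
                                         := X :* ((E :* S :+ S′) :+ (E′ :* G :+ H)))
                 refl X (e c) SG (e-prev c) (G k) SV (shift m (V c) k) ⟩
      X * ((e c * SG + SV) + V-prev c k)
        ≡⟨ cong (λ q → X * (q + V-prev c k))
                (trans (sym (shiftSum-linear m′ (e c) G (shift m (V (suc c))) k))
                       (shiftSum-cong m′ k (λ u _ → sym (V-split c u)))) ⟩
      X * (shiftSum (V c) m′ k + V-prev c k)
        ∎
      where
      SG = shiftSum G m′ k
      SV = shiftSum (shift m (V (suc c))) m′ k

      base-term : ⟦ k ℕ.+ c ℕ.* m ⟧ * (e c * G k) ≡ X * (e c * SG + e-prev c * G k)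
      base-term = begin
        ⟦ k ℕ.+ c ℕ.* m ⟧ * (e c * G k)
          ≡⟨ cong (_* (e c * G k)) (⟦⟧-+ k (c ℕ.* m)) ⟩
        (⟦ k ⟧ + ⟦ c ℕ.* m ⟧) * (e c * G k)
          ≡⟨ solve 4 (λ K C E G → (K :+ C) :* (E :* G) := E :* (K :* G) :+ (C :* E) :* G) refl ⟦ k ⟧ ⟦ c ℕ.* m ⟧ (e c) (G k) ⟩
        e c * (⟦ k ⟧ * G k) + (⟦ c ℕ.* m ⟧ * e c) * G k
          ≡⟨ cong₂ (λ p q → e c * p + q * G k) (newton-m′ k) (e-rec c) ⟩
        e c * (X * SG) + (X * e-prev c) * G k
          ≡⟨ solve 5 (λ X E S E′ G → E :* (X :* S) :+ (X :* E′) :* G := X :* (E :* S :+ E′ :* G)) refl X (e c) SG (e-prev c) (G k) ⟩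
        X * (e c * SG + e-prev c * G k)
          ∎

      shifted-term : ⟦ k ℕ.+ c ℕ.* m ⟧ * shift m (V (suc c)) k ≡ X * shift m (λ j → shiftSum (V (suc c)) m′ j + V c j) k
      shifted-term = begin
        ⟦ k ℕ.+ c ℕ.* m ⟧ * shift m (V (suc c)) k
          ≡⟨ shift-scale m (λ k → ⟦ k ℕ.+ c ℕ.* m ⟧) (V (suc c)) k ⟩
        shift m (λ j → ⟦ m ℕ.+ j ℕ.+ c ℕ.* m ⟧ * V (suc c) j) k
          ≡⟨ shift-cong m k at-j ⟩
        shift m (λ j → X * (shiftSum (V (suc c)) m′ j + V c j)) k
          ≡⟨ shift-*ˡ m X (λ j → shiftSum (V (suc c)) m′ j + V c j) k ⟩
        X * shift m (λ j → shiftSum (V (suc c)) m′ j + V c j) k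
          ∎
        where
        at-j : ∀ j → m ℕ.+ j ≡ k → ⟦ m ℕ.+ j ℕ.+ c ℕ.* m ⟧ * V (suc c) j ≡ X * (shiftSum (V (suc c)) m′ j + V c j)
        at-j j m+j≡k = begin
          ⟦ m ℕ.+ j ℕ.+ c ℕ.* m ⟧ * V (suc c) j
            ≡⟨ cong (λ n → ⟦ n ⟧ * V (suc c) j) degree ⟩
          ⟦ j ℕ.+ suc c ℕ.* m ⟧ * V (suc c) j
            ≡⟨ rec (subst (j ℕ.<_) m+j≡k (ℕₚ.m<n+m j (ℕ.s≤s ℕ.z≤n))) (suc c) ⟩
          X * (shiftSum (V (suc c)) m′ j + V-prev (suc c) j)
            ≡⟨ cong (λ q → X * (shiftSum (V (suc c)) m′ j + q)) (V-split c j) ⟨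
          X * (shiftSum (V (suc c)) m′ j + V c j)
            ∎
          where
          degree : m ℕ.+ j ℕ.+ c ℕ.* m ≡ j ℕ.+ suc c ℕ.* m
          degree = trans (cong (ℕ._+ c ℕ.* m) (ℕₚ.+-comm m j)) (ℕₚ.+-assoc j m (c ℕ.* m))

    newton-m : ∀ k → ⟦ k ⟧ * A m k ≡ X * shiftSum (A m) m k
    newton-m k = begin
      ⟦ k ⟧ * A m k                                           ≡⟨ cong (λ n → ⟦ n ⟧ * A m k) (ℕₚ.+-identityʳ k) ⟨
      ⟦ k ℕ.+ 0 ⟧ * V 0 k                                     ≡⟨ <-rec NewtonV newton-V-step k 0 ⟩
      X * (shiftSum (A m) m′ k + (0ℚ * G k + shift m (A m) k)) ≡⟨ cong (λ q → X * (shiftSum (A m) m′ k + q)) V-prev-0 ⟩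
      X * shiftSum (A m) m k                                  ∎
      where
      V-prev-0 : 0ℚ * G k + shift m (A m) k ≡ shift m (A m) k
      V-prev-0 = trans (cong (_+ shift m (A m) k) (ℚₚ.*-zeroˡ (G k))) (ℚₚ.+-identityˡ _)

  newton : ∀ m k → ⟦ k ⟧ * A m k ≡ X * shiftSum (A m) m k
  newton zero     zero    = trans (ℚₚ.*-zeroˡ (A 0 0)) (sym (ℚₚ.*-zeroʳ X))
  newton zero     (suc k) = trans (ℚₚ.*-zeroʳ ⟦ suc k ⟧) (sym (ℚₚ.*-zeroʳ X))
  newton (suc m′) = Step.newton-m m′ (newton m′)

module Binomials where

  open import Data.Nat using (zero; suc; _+_; _*_; _^_; _≤_)
  import Data.Nat.Properties as ℕₚ
  open import Data.Nat.Combinatorics using (_C_; nC1≡n; nCn≡1; nCk+nC[k+1]≡[n+1]C[k+1])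
  open import Data.Nat.Solver using (module +-*-Solver)
  open +-*-Solver using (solve; _:+_; _:*_; _:=_)

  [1+k]*[1+n]C[1+k]≡[1+n]*nCk : ∀ n k → suc k * (suc n C suc k) ≡ suc n * (n C k)
  [1+k]*[1+n]C[1+k]≡[1+n]*nCk zero    zero    = refl
  [1+k]*[1+n]C[1+k]≡[1+n]*nCk zero    (suc k) = ℕₚ.*-zeroʳ (suc (suc k))
  [1+k]*[1+n]C[1+k]≡[1+n]*nCk (suc n) zero    =
    trans (ℕₚ.+-identityʳ _) (trans (nC1≡n (suc (suc n))) (sym (ℕₚ.*-identityʳ (suc (suc n)))))
  [1+k]*[1+n]C[1+k]≡[1+n]*nCk (suc n) (suc k) = begin
    suc (suc k) * (suc (suc n) C suc (suc k))
      ≡⟨ cong (suc (suc k) *_) (nCk+nC[k+1]≡[n+1]C[k+1] (suc n) (suc k)) ⟨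
    suc (suc k) * (c + suc n C suc (suc k))
      ≡⟨ ℕₚ.*-distribˡ-+ (suc (suc k)) c _ ⟩
    (c + suc k * c) + suc (suc k) * (suc n C suc (suc k))
      ≡⟨ cong₂ (λ p q → (c + p) + q) ([1+k]*[1+n]C[1+k]≡[1+n]*nCk n k) ([1+k]*[1+n]C[1+k]≡[1+n]*nCk n (suc k)) ⟩
    (c + suc n * (n C k)) + suc n * (n C suc k)
      ≡⟨ solve 4 (λ c n p q → (c :+ n :* p) :+ n :* q := c :+ n :* (p :+ q)) refl c (suc n) (n C k) (n C suc k) ⟩
    c + suc n * (n C k + n C suc k)
      ≡⟨ cong (λ q → c + suc n * q) (nCk+nC[k+1]≡[n+1]C[k+1] n k) ⟩
    suc (suc n) * c
      ∎
    where
    open ≡-Reasoning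
    c = suc n C suc k

  [k+j]Ck*p^k*q^j≤[p+q]^[k+j] : ∀ k j p q → ((k + j) C k) * (p ^ k * q ^ j) ≤ (p + q) ^ (k + j)
  [k+j]Ck*p^k*q^j≤[p+q]^[k+j] zero    j       p q = begin
    (j C 0) * (1 * q ^ j)   ≡⟨ trans (ℕₚ.*-identityˡ (1 * q ^ j)) (ℕₚ.*-identityˡ (q ^ j)) ⟩
    q ^ j                   ≤⟨ ℕₚ.^-monoˡ-≤ j (ℕₚ.m≤n+m q p) ⟩
    (p + q) ^ j             ∎
    where open ℕₚ.≤-Reasoning
  [k+j]Ck*p^k*q^j≤[p+q]^[k+j] (suc k) zero    p q = begin
    ((suc k + 0) C suc k) * (p ^ suc k * 1)   ≡⟨ cong₂ (λ n r → (n C suc k) * r) (ℕₚ.+-identityʳ (suc k)) (ℕₚ.*-identityʳ _) ⟩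
    (suc k C suc k) * p ^ suc k               ≡⟨ trans (cong (_* p ^ suc k) (nCn≡1 (suc k))) (ℕₚ.*-identityˡ _) ⟩
    p ^ suc k                                 ≤⟨ ℕₚ.^-monoˡ-≤ (suc k) (ℕₚ.m≤m+n p q) ⟩
    (p + q) ^ suc k                           ≡⟨ cong ((p + q) ^_) (ℕₚ.+-identityʳ (suc k)) ⟨
    (p + q) ^ (suc k + 0)                     ∎
    where open ℕₚ.≤-Reasoning
  [k+j]Ck*p^k*q^j≤[p+q]^[k+j] (suc k) (suc j) p q = begin
    (suc (k + suc j) C suc k) * (p ^ suc k * q ^ suc j)
      ≡⟨ cong (_* (p ^ suc k * q ^ suc j)) (nCk+nC[k+1]≡[n+1]C[k+1] (k + suc j) k) ⟨
    ((k + suc j) C k + (k + suc j) C suc k) * (p ^ suc k * q ^ suc j)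
      ≡⟨ solve 6 (λ c c′ p pk q qj → (c :+ c′) :* ((p :* pk) :* (q :* qj))
                                     := p :* (c :* (pk :* (q :* qj))) :+ q :* (c′ :* ((p :* pk) :* qj)))
               refl ((k + suc j) C k) ((k + suc j) C suc k) p (p ^ k) q (q ^ j) ⟩
    p * (((k + suc j) C k) * (p ^ k * q ^ suc j)) + q * (((k + suc j) C suc k) * (p ^ suc k * q ^ j))
      ≤⟨ ℕₚ.+-mono-≤ (ℕₚ.*-monoʳ-≤ p ([k+j]Ck*p^k*q^j≤[p+q]^[k+j] k (suc j) p q)) (ℕₚ.*-monoʳ-≤ q suc-k-term) ⟩
    p * (p + q) ^ (k + suc j) + q * (p + q) ^ (k + suc j)
      ≡⟨ ℕₚ.*-distribʳ-+ ((p + q) ^ (k + suc j)) p q ⟨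
    (p + q) ^ suc (k + suc j)
      ∎
    where
    open ℕₚ.≤-Reasoning
    suc-k-term : ((k + suc j) C suc k) * (p ^ suc k * q ^ j) ≤ (p + q) ^ (k + suc j)
    suc-k-term = subst (λ n → (n C suc k) * (p ^ suc k * q ^ j) ≤ (p + q) ^ n) (sym (ℕₚ.+-suc k j))
                       ([k+j]Ck*p^k*q^j≤[p+q]^[k+j] (suc k) j p q)

module BinomialSums (x : ℕ) where

  open import Data.Nat as ℕ using (zero; suc; _+_)
  import Data.Nat.Properties as ℕₚ
  open import Data.Nat.Combinatorics using (_C_)
  open import Data.Rational as ℚ using (ℚ; 0ℚ; 1ℚ; _*_; _≤_)
  import Data.Rational.Properties as ℚₚ
  open Rationals
  open Sequences
  open Binomials using ([1+k]*[1+n]C[1+k]≡[1+n]*nCk)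
  open KroneckerBound using (weight)
  open BoundedPartitions using (partitions≤-saturated)
  open Newton x using (X; A; newton)

  -- shiftSum a t t = a 0 + ⋯ + a (t - 1); the recurrence is Newton's identity for (1 - t)^(-x)
  partialSum-binomial : ∀ (a : ℕ → ℚ) → a 0 ≡ 1ℚ → (∀ t → ⟦ t ⟧ * a t ≡ X * shiftSum a t t) →
                        ∀ t → shiftSum a (suc t) (suc t) ≡ ⟦ (x + t) C t ⟧
  partialSum-binomial a a₀≡1 rec zero    = trans (shiftSum-suc-suc a 0 0) (trans (ℚₚ.+-identityʳ (a 0)) a₀≡1)
  partialSum-binomial a a₀≡1 rec (suc t) = ⟦⟧*-cancel (suc t) (begin
    ⟦ suc t ⟧ * s (suc (suc t))                             ≡⟨ cong (⟦ suc t ⟧ *_) (shiftSum-suc-suc a (suc t) (suc t)) ⟩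
    ⟦ suc t ⟧ * (a (suc t) ℚ.+ s (suc t))                   ≡⟨ ℚₚ.*-distribˡ-+ ⟦ suc t ⟧ (a (suc t)) (s (suc t)) ⟩
    ⟦ suc t ⟧ * a (suc t) ℚ.+ ⟦ suc t ⟧ * s (suc t)         ≡⟨ cong (ℚ._+ ⟦ suc t ⟧ * s (suc t)) (rec (suc t)) ⟩
    X * s (suc t) ℚ.+ ⟦ suc t ⟧ * s (suc t)                 ≡⟨ ℚₚ.*-distribʳ-+ (s (suc t)) X ⟦ suc t ⟧ ⟨
    (X ℚ.+ ⟦ suc t ⟧) * s (suc t)                           ≡⟨ cong₂ _*_ (sym (⟦⟧-+ x (suc t)))
                                                                          (partialSum-binomial a a₀≡1 rec t) ⟩
    ⟦ x + suc t ⟧ * ⟦ (x + t) C t ⟧                         ≡⟨ ⟦⟧-* (x + suc t) ((x + t) C t) ⟨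
    ⟦ (x + suc t) ℕ.* ((x + t) C t) ⟧                       ≡⟨ cong ⟦_⟧ absorption ⟩
    ⟦ suc t ℕ.* ((x + suc t) C suc t) ⟧                     ≡⟨ ⟦⟧-* (suc t) ((x + suc t) C suc t) ⟩
    ⟦ suc t ⟧ * ⟦ (x + suc t) C suc t ⟧                     ∎)
    where
    open ≡-Reasoning
    s : ℕ → ℚ
    s t = shiftSum a t t
    absorption : (x + suc t) ℕ.* ((x + t) C t) ≡ suc t ℕ.* ((x + suc t) C suc t)
    absorption = trans (cong (λ n → n ℕ.* ((x + t) C t)) (ℕₚ.+-suc x t))
      (trans (sym ([1+k]*[1+n]C[1+k]≡[1+n]*nCk (x + t) t))
             (cong (λ n → suc t ℕ.* (n C suc t)) (sym (ℕₚ.+-suc x t))))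

  sum-weight≤[x+n]Cn : ∀ n → sumℚ (map (weight x) (partitionsOf n)) ≤ ⟦ (x + n) C n ⟧
  sum-weight≤[x+n]Cn n = begin
    a n                                  ≡⟨ ℚₚ.+-identityʳ (a n) ⟨
    a n ℚ.+ 0ℚ                           ≤⟨ ℚₚ.+-monoʳ-≤ (a n) (partialSum-nonneg n) ⟩
    a n ℚ.+ shiftSum a n n               ≡⟨ shiftSum-suc-suc a n n ⟨
    shiftSum a (suc n) (suc n)           ≡⟨ partialSum-binomial a refl a-rec n ⟩
    ⟦ (x + n) C n ⟧                      ∎
    where
    open ℚₚ.≤-Reasoning
    a : ℕ → ℚ
    a t = A t t
    a-rec : ∀ t → ⟦ t ⟧ * a t ≡ X * shiftSum a t t
    a-rec t = trans (newton t t) (cong (X *_) (shiftSum-cong t t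
      (λ u u<t → cong (sumℚ ∘ map (weight x)) (partitions≤-saturated u t (ℕₚ.<⇒≤ u<t)))))
    partialSum-nonneg : ∀ t → 0ℚ ≤ shiftSum a t t
    partialSum-nonneg zero    = ℚₚ.≤-refl
    partialSum-nonneg (suc t) =
      ℚₚ.≤-trans (⟦⟧-mono {b = (x + t) C t} ℕ.z≤n) (ℚₚ.≤-reflexive (sym (partialSum-binomial a refl a-rec t)))

module BinomialBound where

  open import Data.Nat as ℕ using (zero; suc; _+_; _^_; _<_)
  import Data.Nat.Properties as ℕₚ
  open import Data.Nat.Combinatorics using (_C_)
  open import Data.Integer using (+_)
  open import Data.Rational as ℚ using (ℚ; 1ℚ; _*_; _≤_)
  import Data.Rational.Properties as ℚₚ
  open import Data.Rational.Solver using (module +-*-Solver)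
  open +-*-Solver using (solve; _:*_; _:=_)
  open Rationals
  open Binomials using ([k+j]Ck*p^k*q^j≤[p+q]^[k+j])

  powℚ-* : ∀ p q k → powℚ (p * q) k ≡ powℚ p k * powℚ q k
  powℚ-* p q zero    = refl
  powℚ-* p q (suc k) = trans (cong (p * q *_) (powℚ-* p q k))
    (solve 4 (λ p q a b → (p :* q) :* (a :* b) := (p :* a) :* (q :* b)) refl p q (powℚ p k) (powℚ q k))

  powℚ-⟦⟧ : ∀ a k → powℚ ⟦ a ⟧ k ≡ ⟦ a ^ k ⟧
  powℚ-⟦⟧ a zero    = refl
  powℚ-⟦⟧ a (suc k) = trans (cong (⟦ a ⟧ *_) (powℚ-⟦⟧ a k)) (sym (⟦⟧-* a (a ^ k)))

  ⟦n^k⟧*[1+a/n]^k≡⟦[n+a]^k⟧ : ∀ n a k →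
    ⟦ suc n ^ k ⟧ * powℚ (1ℚ ℚ.+ frac (+ a) (suc n)) k ≡ ⟦ (suc n + a) ^ k ⟧
  ⟦n^k⟧*[1+a/n]^k≡⟦[n+a]^k⟧ n a k = begin
    ⟦ suc n ^ k ⟧ * powℚ 1+a/n k          ≡⟨ cong (_* powℚ 1+a/n k) (powℚ-⟦⟧ (suc n) k) ⟨
    powℚ ⟦ suc n ⟧ k * powℚ 1+a/n k       ≡⟨ powℚ-* ⟦ suc n ⟧ 1+a/n k ⟨
    powℚ (⟦ suc n ⟧ * 1+a/n) k            ≡⟨ cong (λ q → powℚ q k) n*[1+a/n] ⟩
    powℚ ⟦ suc n + a ⟧ k                  ≡⟨ powℚ-⟦⟧ (suc n + a) k ⟩
    ⟦ (suc n + a) ^ k ⟧                   ∎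
    where
    open ≡-Reasoning
    1+a/n = 1ℚ ℚ.+ frac (+ a) (suc n)
    n*[1+a/n] : ⟦ suc n ⟧ * 1+a/n ≡ ⟦ suc n + a ⟧
    n*[1+a/n] = trans (ℚₚ.*-distribˡ-+ ⟦ suc n ⟧ 1ℚ _)
      (trans (cong₂ ℚ._+_ (ℚₚ.*-identityʳ ⟦ suc n ⟧) (⟦1+d⟧*a/[1+d]≡⟦a⟧ n a)) (sym (⟦⟧-+ (suc n) a)))

  -- after multiplying by n^n x^x the left side is one term of the binomial expansion of (n + x)^(n + x)
  [x+n]Cn≤[1+x/n]^n*[1+n/x]^x : ∀ n x → 0 < n → 0 < x →
    ⟦ (x + n) C n ⟧ ≤ powℚ (1ℚ ℚ.+ frac (+ x) n) n * powℚ (1ℚ ℚ.+ frac (+ n) x) x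
  [x+n]Cn≤[1+x/n]^n*[1+n/x]^x n@(suc n′) x@(suc x′) _ _ = ⟦⟧*-cancel-≤ D (begin
    ⟦ D ⟧ * ⟦ (x + n) C n ⟧               ≡⟨ ⟦⟧-* D ((x + n) C n) ⟨
    ⟦ D ℕ.* ((x + n) C n) ⟧               ≤⟨ ⟦⟧-mono one-term ⟩
    ⟦ (n + x) ^ (n + x) ⟧                 ≡⟨ cong ⟦_⟧ split-power ⟩
    ⟦ (n + x) ^ n ℕ.* (x + n) ^ x ⟧       ≡⟨ ⟦⟧-* ((n + x) ^ n) ((x + n) ^ x) ⟩
    ⟦ (n + x) ^ n ⟧ * ⟦ (x + n) ^ x ⟧     ≡⟨ cong₂ _*_ (⟦n^k⟧*[1+a/n]^k≡⟦[n+a]^k⟧ n′ x n)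
                                                       (⟦n^k⟧*[1+a/n]^k≡⟦[n+a]^k⟧ x′ n x) ⟨
    (⟦ n ^ n ⟧ * P) * (⟦ x ^ x ⟧ * Q)     ≡⟨ solve 4 (λ a p b q → (a :* p) :* (b :* q) := (a :* b) :* (p :* q))
                                                     refl ⟦ n ^ n ⟧ P ⟦ x ^ x ⟧ Q ⟩
    (⟦ n ^ n ⟧ * ⟦ x ^ x ⟧) * (P * Q)     ≡⟨ cong (_* (P * Q)) (⟦⟧-* (n ^ n) (x ^ x)) ⟨
    ⟦ D ⟧ * (P * Q)                       ∎)
    where
    open ℚₚ.≤-Reasoning
    D = n ^ n ℕ.* x ^ x
    instance
      D≢0 : ℕ.NonZero D
      D≢0 = ℕₚ.m*n≢0 (n ^ n) (x ^ x) {{ℕₚ.m^n≢0 n n}} {{ℕₚ.m^n≢0 x x}}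
    P = powℚ (1ℚ ℚ.+ frac (+ x) n) n
    Q = powℚ (1ℚ ℚ.+ frac (+ n) x) x
    one-term : D ℕ.* ((x + n) C n) ℕ.≤ (n + x) ^ (n + x)
    one-term = subst (λ m → m ℕ.≤ (n + x) ^ (n + x))
                     (trans (ℕₚ.*-comm ((n + x) C n) D) (cong (λ m → D ℕ.* (m C n)) (ℕₚ.+-comm n x)))
                     ([k+j]Ck*p^k*q^j≤[p+q]^[k+j] n x n x)
    split-power : (n + x) ^ (n + x) ≡ (n + x) ^ n ℕ.* (x + n) ^ x
    split-power = trans (ℕₚ.^-distribˡ-+-* (n + x) n x) (cong (λ m → (n + x) ^ n ℕ.* m ^ x) (ℕₚ.+-comm n x))

open import Data.Nat using (_+_; _≤_; _*_; s≤s; z≤n)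
import Data.Nat.Properties as ℕₚ
open import Data.Nat.Combinatorics using (_C_)
open import Data.Integer using (+_)
open import Data.Rational using (1ℚ) renaming (_≤_ to _≤ℚ_; _+_ to _+ℚ_; _*_ to _*ℚ_)
import Data.Rational.Properties as ℚₚ
open Rationals using (⟦_⟧)
open KroneckerBound using (weight; kron≤sum-weight)
open BinomialSums using (sum-weight≤[x+n]Cn)
open BinomialBound using ([x+n]Cn≤[1+x/n]^n*[1+n/x]^x)

len-positive : ∀ {n} (p : Partition n) → 1 ≤ n → 1 ≤ len p
len-positive (mkPartition []      _ _ refl) ()
len-positive (mkPartition (_ ∷ _) _ _ _)    _ = s≤s z≤n

theorem5p3 : (n : ℕ) → 1 ≤ n → (la mu nu : Partition n) →
  kron la mu nu ≤ℚ
    (powℚ (1ℚ +ℚ frac (+ (len la * len mu * len nu)) n) n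
      *ℚ powℚ (1ℚ +ℚ frac (+ n) (len la * len mu * len nu)) (len la * len mu * len nu))
theorem5p3 n 1≤n la mu nu = begin
  kron la mu nu                                                          ≤⟨ kron≤sum-weight la mu nu ⟩
  sumℚ (map (weight x) (partitionsOf n))                                 ≤⟨ sum-weight≤[x+n]Cn x n ⟩
  ⟦ (x + n) C n ⟧                                                        ≤⟨ [x+n]Cn≤[1+x/n]^n*[1+n/x]^x n x 1≤n 1≤x ⟩
  powℚ (1ℚ +ℚ frac (+ x) n) n *ℚ powℚ (1ℚ +ℚ frac (+ n) x) x            ∎
  where
  open ℚₚ.≤-Reasoning
  x = len la * len mu * len nu
  1≤x : 1 ≤ x
  1≤x = ℕₚ.*-mono-≤ (ℕₚ.*-mono-≤ (len-positive la 1≤n) (len-positive mu 1≤n)) (len-positive nu 1≤n)
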